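{- Let $N\colon\mathbb{B}^L\to\mathbb{B}^L$ be the reduced Boolean Delta-Notch system over a graph $\mathcal{G}$ as in the context, let $x\in\mathbb{B}^L$ be a fixed point of $N$ and let $H\subseteq C$. Define $H_0=\{i\in H: x_i=0\}$, $H_1=\{i\in H: x_i=1\}$, $K=\{j\in S(H_1)\setminus H : x_j=0\}$, $J=\{j\in S(K\cup H_0)\setminus H : x_h=1 \text{ for all } h\in S(j)\setminus(K\cup H_0)\}$, and $I=H\cup K\cup J$. Then $x[I]$ is the minimal (for inclusion) trap space for $N$ containing $x[H]$.
   Context: Let $L\ge 1$ and let $\mathcal{G}$ be an undirected connected graph without loops on the vertex set $C=\{1,\dots,L\}$. For $i\in C$ let $S(i)$ be the set of neighbours of $i$ in $\mathcal{G}$, and for $A\subseteq C$ let $S(A)=\bigcup_{i\in A}S(i)$. $\mathbb{B}=\{0,1\}$. The reduced Boolean Delta-Notch system is $N\colon\mathbb{B}^L\to\mathbb{B}^L$, $N_i(n)=\bigvee_{j\in S(i)}(1-n_j)$ (empty disjunction $=0$). The asynchronous dynamics $AD_N$ has an edge from $x$ to the state obtained by flipping coordinate $i$ whenever $N_i(x)\neq x_i$. For $x\in\mathbb{B}^L$, $I\subseteq C$, the subspace $x[I]$ is $\{y: y_i=x_i\ \forall i\notin I\}$. A trap space is a subspace $A$ such that every successor in $AD_N$ of a state of $A$ lies in $A$. -}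

module Defs where

open import Data.Nat using (ℕ)
open import Data.Bool using (Bool; true; false; _∧_; _∨_; not; if_then_else_)
open import Data.Fin using (Fin; _≟_)
open import Data.Bool.ListAction using (any; all)
open import Data.List using () renaming (allFin to allFinL)
open import Relation.Nullary.Decidable using (⌊_⌋)
open import Relation.Binary.PropositionalEquality using (_≡_; _≢_)
open import Data.Product using (Σ)

Graph : ℕ → Set
Graph L = Fin L → Fin L → Bool

State : ℕ → Set
State L = Fin L → Bool

Subset : ℕ → Set
Subset L = Fin L → Bool

Symmetric : ∀ {L} → Graph L → Set
Symmetric {L} G = ∀ (i j : Fin L) → G i j ≡ G j i

Loopless : ∀ {L} → Graph L → Set
Loopless {L} G = ∀ (i : Fin L) → G i i ≡ false

data Reach {L} (G : Graph L) : Fin L → Fin L → Set where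
  here : ∀ {i} → Reach G i i
  step : ∀ {i k j} → G i k ≡ true → Reach G k j → Reach G i j

Connected : ∀ {L} → Graph L → Set
Connected {L} G = ∀ (i j : Fin L) → Reach G i j

inS : ∀ {L} → Graph L → Subset L → Fin L → Bool
inS {L} G A j = any (λ k → A k ∧ G k j) (allFinL L)

N : ∀ {L} → Graph L → State L → State L
N {L} G n i = any (λ j → G i j ∧ not (n j)) (allFinL L)

flip : ∀ {L} → State L → Fin L → State L
flip x i k = if ⌊ k ≟ i ⌋ then not (x k) else x k

_∈sub_[_] : ∀ {L} → State L → State L → Subset L → Set
_∈sub_[_] {L} y x I = ∀ (i : Fin L) → I i ≡ false → y i ≡ x i

_[_]⊆_[_] : ∀ {L} → State L → Subset L → State L → Subset L → Set
_[_]⊆_[_] {L} x I y I' = ∀ (z : State L) → z ∈sub x [ I ] → z ∈sub y [ I' ]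

TrapSpace : ∀ {L} → Graph L → State L → Subset L → Set
TrapSpace {L} G x I =
  ∀ (y : State L) → y ∈sub x [ I ] → ∀ (i : Fin L) → N G y i ≢ y i →
  flip y i ∈sub x [ I ]

FixedPoint : ∀ {L} → Graph L → State L → Set
FixedPoint {L} G x = ∀ (i : Fin L) → N G x i ≡ x i

H0 : ∀ {L} → State L → Subset L → Subset L
H0 x H i = H i ∧ not (x i)

H1 : ∀ {L} → State L → Subset L → Subset L
H1 x H i = H i ∧ x i

Kset : ∀ {L} → Graph L → State L → Subset L → Subset L
Kset G x H j = inS G (H1 x H) j ∧ not (H j) ∧ not (x j)

KH0 : ∀ {L} → Graph L → State L → Subset L → Subset L
KH0 G x H i = Kset G x H i ∨ H0 x H i

Jset : ∀ {L} → Graph L → State L → Subset L → Subset L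
Jset {L} G x H j =
  inS G (KH0 G x H) j ∧ not (H j) ∧
  all (λ h → not (G j h ∧ not (KH0 G x H h)) ∨ x h) (allFinL L)

Iset : ∀ {L} → Graph L → State L → Subset L → Subset L
Iset G x H i = H i ∨ Kset G x H i ∨ Jset G x H i

-- At a fixed point x every 0-cell has only 1-neighbours and every 1-cell has a
-- 0-neighbour. A subspace x[I] is a trap space exactly when N agrees with x
-- outside I on every state of x[I]. For a fixed 0-cell no neighbour lies in I,
-- so all its neighbours stay 1; for a fixed 1-cell a 0-neighbour either lies
-- outside I or lies in K ∪ H₀, and then the cell not being in J yields a
-- 0-neighbour outside K ∪ H₀, hence outside I. Conversely a trap space y[I']
-- containing x[H] must free H (flip a coordinate of H), then K (flipping a
-- neighbour in H₁ to 0 activates the cell), then J (raising all of K ∪ H₀ to 1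
-- switches the cell off).
module Submission where

open import Defs
open import Data.Nat using (ℕ; _≤_)
open import Data.Bool using (Bool; true; false; T; not; _∧_; _∨_)
open import Data.Bool.Properties
  using (T-≡; not-injective; not-¬; ¬-not; ∨-conicalˡ; ∨-conicalʳ; ∨-zeroʳ)
  renaming (_≟_ to _≟ᵇ_)
open import Data.Bool.ListAction using (any; all)
open import Data.Fin using (Fin; _≟_)
open import Data.List using () renaming (allFin to allFinL)
open import Data.List.Membership.Propositional using (lose)
open import Data.List.Membership.Propositional.Properties using (∈-allFin)
open import Data.List.Relation.Unary.Any using (satisfied)
open import Data.List.Relation.Unary.Any.Properties using (any⁺; any⁻)
open import Data.List.Relation.Unary.All using (lookup)
open import Data.List.Relation.Unary.All.Properties using (all⁺; all⁻; ¬All⇒Any¬)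
open import Data.Product using (_×_; _,_; ∃; proj₁; proj₂)
open import Data.Empty using (⊥)
open import Data.Sum using (_⊎_; inj₁; inj₂)
open import Function using (_∘_; Equivalence)
open import Relation.Nullary using (yes; no; contradiction)
open import Relation.Nullary.Decidable using (T?)
open import Relation.Binary.PropositionalEquality
  using (_≡_; refl; sym; trans; cong; cong₂; subst; subst₂)

∧≡true : ∀ {a b} → a ∧ b ≡ true → a ≡ true × b ≡ true
∧≡true {true} {true} _ = refl , refl

∨≡true : ∀ {a b} → a ∨ b ≡ true → a ≡ true ⊎ b ≡ true
∨≡true {true}  _ = inj₁ refl
∨≡true {false} e = inj₂ e

module _ {L : ℕ} (f : Fin L → Bool) where

  any-allFin⁺ : ∀ k → f k ≡ true → any f (allFinL L) ≡ true
  any-allFin⁺ k fk =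
    Equivalence.to T-≡ (any⁺ f (lose (∈-allFin k) (Equivalence.from T-≡ fk)))

  any-allFin⁻ : any f (allFinL L) ≡ true → ∃ λ k → f k ≡ true
  any-allFin⁻ e =
    let k , fk = satisfied (any⁻ f (allFinL L) (Equivalence.from T-≡ e))
    in  k , Equivalence.to T-≡ fk

  all-allFin⁻ : all f (allFinL L) ≡ true → ∀ k → f k ≡ true
  all-allFin⁻ e k =
    Equivalence.to T-≡ (lookup (all⁺ f _ (Equivalence.from T-≡ e)) (∈-allFin k))

  all-allFin≡false⁻ : all f (allFinL L) ≡ false → ∃ λ k → f k ≡ false
  all-allFin≡false⁻ e =
    let k , ¬fk = satisfied (¬All⇒Any¬ (T? ∘ f) (allFinL L)
                               λ fs → subst T e (all⁻ f {xs = allFinL L} fs))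
    in  k , ¬-not (¬fk ∘ Equivalence.from T-≡)

module _ {L : ℕ} (G : Graph L) where

  N≡true⁺ : ∀ {n i j} → G i j ≡ true → n j ≡ false → N G n i ≡ true
  N≡true⁺ {j = j} gij nj = any-allFin⁺ _ j (cong₂ (λ g b → g ∧ not b) gij nj)

  N≡true⁻ : ∀ {n i} → N G n i ≡ true → ∃ λ j → G i j ≡ true × n j ≡ false
  N≡true⁻ e =
    let j , w = any-allFin⁻ _ e ; gij , nj = ∧≡true w
    in  j , gij , not-injective nj

  N≡false⁺ : ∀ {n i} → (∀ j → G i j ≡ true → n j ≡ true) → N G n i ≡ false
  N≡false⁺ ones = ¬-not λ e → let j , gij , nj = N≡true⁻ e in not-¬ (ones j gij) nj

  inS≡true⁺ : ∀ {A k j} → A k ≡ true → G k j ≡ true → inS G A j ≡ true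
  inS≡true⁺ {k = k} Ak gkj = any-allFin⁺ _ k (cong₂ _∧_ Ak gkj)

  inS≡true⁻ : ∀ {A j} → inS G A j ≡ true → ∃ λ k → A k ≡ true × G k j ≡ true
  inS≡true⁻ e = let k , w = any-allFin⁻ _ e in k , ∧≡true w

module _ {L : ℕ} {G : Graph L} {x : State L} (fixed : FixedPoint G x) where

  fixed-zero⇒neighbours-one : ∀ {i j} → x i ≡ false → G i j ≡ true → x j ≡ true
  fixed-zero⇒neighbours-one {i} xi gij =
    ¬-not λ xj → not-¬ (N≡true⁺ G gij xj) (trans (fixed i) xi)

  fixed-one⇒zero-neighbour : ∀ {i} → x i ≡ true → ∃ λ j → G i j ≡ true × x j ≡ false
  fixed-one⇒zero-neighbour {i} xi = N≡true⁻ G (trans (fixed i) xi)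

flip-here : ∀ {L} (x : State L) i → flip x i i ≡ not (x i)
flip-here x i with i ≟ i
... | yes _   = refl
... | no i≢i = contradiction refl i≢i

flip∈sub : ∀ {L} {x : State L} {A : Subset L} {i} → A i ≡ true → flip x i ∈sub x [ A ]
flip∈sub {i = i} Ai k Ak with k ≟ i
... | yes refl = contradiction Ak (not-¬ Ai)
... | no _     = refl

subspace-mono : ∀ {L} {x y : State L} {I I' : Subset L} →
                (∀ i → I' i ≡ false → I i ≡ false) → x ∈sub y [ I' ] → x [ I ]⊆ y [ I' ]
subspace-mono I⊆I' x∈ z z∈ i I'i = trans (z∈ i (I⊆I' i I'i)) (x∈ i I'i)

Stable : ∀ {L} → Graph L → State L → Subset L → Set
Stable {L} G x I = ∀ (y : State L) → y ∈sub x [ I ] → ∀ i → I i ≡ false → N G y i ≡ x i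

module _ {L : ℕ} {G : Graph L} {x : State L} {I : Subset L} where

  trap⇒stable : TrapSpace G x I → Stable G x I
  trap⇒stable trap y y∈ i Ii with N G y i ≟ᵇ y i
  ... | yes e  = trans e (y∈ i Ii)
  ... | no Ny≢y = contradiction y≡¬y (not-¬ refl)
    where
      y≡¬y : y i ≡ not (y i)
      y≡¬y = trans (y∈ i Ii) (trans (sym (trap y y∈ i Ny≢y i Ii)) (flip-here y i))

  stable⇒trap : Stable G x I → TrapSpace G x I
  stable⇒trap stable y y∈ i Ny≢y k Ik with k ≟ i
  ... | yes refl = contradiction (trans (stable y y∈ k Ik) (sym (y∈ k Ik))) Ny≢y
  ... | no _     = y∈ k Ik

module _ {L : ℕ} {G : Graph L} (symmetric : Symmetric G)
         {x : State L} (fixed : FixedPoint G x) (H : Subset L) where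

  private
    K KH J I : Subset L
    K  = Kset G x H
    KH = KH0 G x H
    J  = Jset G x H
    I  = Iset G x H

    outside-KH0-is-one : Fin L → Fin L → Bool
    outside-KH0-is-one j h = not (G j h ∧ not (KH h)) ∨ x h

  K≡true⁺ : ∀ {j} → inS G (H1 x H) j ≡ true → H j ≡ false → x j ≡ false → K j ≡ true
  K≡true⁺ s Hj xj = cong₂ _∧_ s (cong₂ (λ h b → not h ∧ not b) Hj xj)

  K≡true⁻ : ∀ {j} → K j ≡ true → inS G (H1 x H) j ≡ true × H j ≡ false × x j ≡ false
  K≡true⁻ e =
    let s , r = ∧≡true e ; Hj , xj = ∧≡true r
    in  s , not-injective Hj , not-injective xj

  KH0≡true⁻ : ∀ {j} → KH j ≡ true → x j ≡ false
  KH0≡true⁻ e with ∨≡true e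
  ... | inj₁ Kj  = let _ , _ , xj = K≡true⁻ Kj in xj
  ... | inj₂ H0j = not-injective (proj₂ (∧≡true H0j))

  KH0≡false⁺ : ∀ {j} → H j ≡ false → K j ≡ false → KH j ≡ false
  KH0≡false⁺ {j} Hj Kj = cong₂ _∨_ Kj (cong (_∧ not (x j)) Hj)

  J≡true⁻ : ∀ {j} → J j ≡ true →
            inS G KH j ≡ true × H j ≡ false ×
            (∀ h → G j h ≡ true → KH h ≡ false → x h ≡ true)
  J≡true⁻ {j} e =
    let s , r = ∧≡true e ; Hj , c = ∧≡true r
    in  s , not-injective Hj ,
        λ h gjh KHh → subst₂ (λ g k → not (g ∧ not k) ∨ x h ≡ true) gjh KHh
                             (all-allFin⁻ _ c h)

  J≡false⁻ : ∀ {j} → J j ≡ false → inS G KH j ≡ true → H j ≡ false →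
             ∃ λ h → G j h ≡ true × KH h ≡ false × x h ≡ false
  J≡false⁻ {j} e s Hj =
    let e′ = subst₂ (λ a b → a ∧ not b ∧ all (outside-KH0-is-one j) (allFinL L) ≡ false) s Hj e
        h , w = all-allFin≡false⁻ _ e′
        gjh , ¬KHh = ∧≡true (not-injective (∨-conicalˡ _ _ w))
    in  h , gjh , not-injective ¬KHh , ∨-conicalʳ _ _ w

  J⇒one : ∀ {j} → J j ≡ true → x j ≡ true
  J⇒one e =
    let s , _ = J≡true⁻ e ; k , KHk , gkj = inS≡true⁻ G s
    in  fixed-zero⇒neighbours-one fixed (KH0≡true⁻ KHk) gkj

  I≡false⁺ : ∀ {i} → H i ≡ false → K i ≡ false → J i ≡ false → I i ≡ false
  I≡false⁺ Hi Ki Ji = cong₂ _∨_ Hi (cong₂ _∨_ Ki Ji)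

  I≡false⁻ : ∀ {i} → I i ≡ false → H i ≡ false × K i ≡ false × J i ≡ false
  I≡false⁻ {i} e =
    let r = ∨-conicalʳ (H i) _ e in ∨-conicalˡ (H i) _ e , ∨-conicalˡ (K i) _ r , ∨-conicalʳ (K i) _ r

  I∧zero⇒KH0 : ∀ {j} → I j ≡ true → x j ≡ false → KH j ≡ true
  I∧zero⇒KH0 {j} e xj with ∨≡true e
  ... | inj₁ Hj = trans (cong₂ (λ h b → K j ∨ (h ∧ not b)) Hj xj) (∨-zeroʳ (K j))
  ... | inj₂ KJj with ∨≡true KJj
  ...   | inj₁ Kj = cong (_∨ (H j ∧ not (x j))) Kj
  ...   | inj₂ Jj = contradiction xj (not-¬ (J⇒one Jj))

  free-zero⇒neighbours-free : ∀ {i j} → I i ≡ false → x i ≡ false → G i j ≡ true → I j ≡ false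
  free-zero⇒neighbours-free {i} {j} Ii xi gij = ¬-not λ Ij → excluded (∨≡true Ij)
    where
      Hi = proj₁ (I≡false⁻ Ii)
      Ki = proj₁ (proj₂ (I≡false⁻ Ii))
      xj = fixed-zero⇒neighbours-one fixed xi gij
      gji = trans (symmetric j i) gij

      excluded : H j ≡ true ⊎ K j ∨ J j ≡ true → ⊥
      excluded (inj₁ Hj) = not-¬ (K≡true⁺ (inS≡true⁺ G (cong₂ _∧_ Hj xj) gji) Hi xi) Ki
      excluded (inj₂ KJj) with ∨≡true KJj
      ... | inj₁ Kj = not-¬ xj (proj₂ (proj₂ (K≡true⁻ Kj)))
      ... | inj₂ Jj = not-¬ (proj₂ (proj₂ (J≡true⁻ Jj)) i gji (KH0≡false⁺ Hi Ki)) xi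

  free-one⇒free-zero-neighbour : ∀ {i} → I i ≡ false → x i ≡ true →
                                 ∃ λ h → G i h ≡ true × I h ≡ false × x h ≡ false
  free-one⇒free-zero-neighbour {i} Ii xi with fixed-one⇒zero-neighbour fixed xi
  ... | j , gij , xj with I j in Ij
  ...   | false = j , gij , Ij , xj
  ...   | true  =
    let Hi , _ , Ji = I≡false⁻ Ii
        s = inS≡true⁺ G (I∧zero⇒KH0 Ij xj) (trans (symmetric j i) gij)
        h , gih , KHh , xh = J≡false⁻ Ji s Hi
    in  h , gih , ¬-not (λ Ih → not-¬ (I∧zero⇒KH0 Ih xh) KHh) , xh

  Iset-stable : Stable G x I
  Iset-stable y y∈ i Ii = N-at (x i) refl
    where
      N-at : ∀ b → x i ≡ b → N G y i ≡ b
      N-at true xi =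
        let h , gih , Ih , xh = free-one⇒free-zero-neighbour Ii xi
        in  N≡true⁺ G gih (trans (y∈ h Ih) xh)
      N-at false xi = N≡false⁺ G λ j gij →
        trans (y∈ j (free-zero⇒neighbours-free Ii xi gij)) (fixed-zero⇒neighbours-one fixed xi gij)

  module _ {y : State L} {I' : Subset L} (trap : TrapSpace G y I') (H⊆ : x [ H ]⊆ y [ I' ]) where

    private
      stable : Stable G y I'
      stable = trap⇒stable trap

      x∈ : x ∈sub y [ I' ]
      x∈ = H⊆ x λ _ _ → refl

    H⊆I' : ∀ {i} → I' i ≡ false → H i ≡ false
    H⊆I' {i} I'i = ¬-not λ Hi →
      not-¬ (sym (x∈ i I'i)) (trans (sym (H⊆ (flip x i) (flip∈sub Hi) i I'i)) (flip-here x i))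

    K⊆I' : ∀ {i} → I' i ≡ false → K i ≡ false
    K⊆I' {i} I'i = ¬-not λ Ki →
      let s , _ , xi = K≡true⁻ Ki
          h , H1h , ghi = inS≡true⁻ G s
          Hh , xh = ∧≡true H1h
          z = flip x h
          Nz≡true = N≡true⁺ G (trans (symmetric i h) ghi) (trans (flip-here x h) (cong not xh))
      in  not-¬ Nz≡true (trans (stable z (H⊆ z (flip∈sub Hh)) i I'i) (trans (sym (x∈ i I'i)) xi))

    KH0⊆I' : ∀ {k} → I' k ≡ false → KH k ≡ false
    KH0⊆I' I'k = KH0≡false⁺ (H⊆I' I'k) (K⊆I' I'k)

    J⊆I' : ∀ {i} → I' i ≡ false → J i ≡ false
    J⊆I' {i} I'i = ¬-not λ Ji →
      not-¬ (trans (stable raised raised∈ i I'i) (trans (sym (x∈ i I'i)) (J⇒one Ji)))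
            (N≡false⁺ G (raised-neighbours-one Ji))
      where
        raised : State L
        raised k = KH k ∨ x k

        raised∈ : raised ∈sub y [ I' ]
        raised∈ k I'k = trans (cong (_∨ x k) (KH0⊆I' I'k)) (x∈ k I'k)

        raised-neighbours-one : J i ≡ true → ∀ h → G i h ≡ true → raised h ≡ true
        raised-neighbours-one Ji h gih with KH h in KHh
        ... | true  = refl
        ... | false = proj₂ (proj₂ (J≡true⁻ Ji)) h gih KHh

    Iset-minimal : x [ I ]⊆ y [ I' ]
    Iset-minimal = subspace-mono (λ _ I'i → I≡false⁺ (H⊆I' I'i) (K⊆I' I'i) (J⊆I' I'i)) x∈

proposition2 : (L : ℕ) → 1 ≤ L → (G : Graph L) → Symmetric G → Loopless G → Connected G →
    (x : State L) → FixedPoint G x → (H : Subset L) →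
    TrapSpace G x (Iset G x H) × x [ H ]⊆ x [ Iset G x H ] ×
    (∀ (y : State L) (I' : Subset L) → TrapSpace G y I' → x [ H ]⊆ y [ I' ] → x [ Iset G x H ]⊆ y [ I' ])
proposition2 L _ G symmetric _ _ x fixed H =
  stable⇒trap (Iset-stable symmetric fixed H) ,
  subspace-mono (λ _ Ii → proj₁ (I≡false⁻ symmetric fixed H Ii)) (λ _ _ → refl) ,
  λ y I' trap H⊆ → Iset-minimal symmetric fixed H trap H⊆
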